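{- Let $\mathcal{S}$ be a single-set cubical $(\omega,p)$-category with connections, let $n\in\mathbb{N}$ and $i\in\mathbb{N}_+$. If $x\in\mathcal{S}^{>n}$ is $r_i$-invertible, then its $r_i$-inverse $r_ix$ also lies in $\mathcal{S}^{>n}$.
   Context: A single-set category is a set $\mathcal{S}$ with $\delta^-,\delta^+:\mathcal{S}\to\mathcal{S}$ and $\odot:\mathcal{S}\times\mathcal{S}\to\mathcal{P}(\mathcal{S})$ (extended to subsets by unions) with $\{x\}\odot(y\odot z)=(x\odot y)\odot\{z\}$, $x\odot\delta^+x=\{x\}=\delta^-x\odot x$, $x\odot y\neq\varnothing\iff\delta^+x=\delta^-y$, and $|x\odot y|\leq1$; $\Delta(x,y)$ means $x\odot y\neq\varnothing$ and $x\circ y$ is its element. A single-set cubical $\omega$-category with connections is a set $\mathcal{S}$ with, for each $i\in\mathbb{N}_+$, a single-set category structure $(\delta_i^\pm,\odot_i)$ (with $\Delta_i,\circ_i$) and maps $s_i,\tilde s_i,\gamma_i^-,\gamma_i^+:\mathcal{S}\to\mathcal{S}$; with $\mathcal{S}^i$ the fixed points of $\delta_i^-$ (equivalently $\delta_i^+$), $\mathcal{S}^{i,j}=\mathcal{S}^i\cap\mathcal{S}^j$, $\mathcal{S}^{>n}=\bigcap_{i>n}\mathcal{S}^i$, the axioms (all $i,j$, $\alpha,\beta$) are: $\delta_i^\alpha\delta_j^\beta=\delta_j^\beta\delta_i^\alpha$ ($i\neq j$); $\delta_i^\alpha(x\circ_jy)=\delta_i^\alpha x\circ_j\delta_i^\alpha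 y$ ($i\neq j$, $\Delta_j(x,y)$); $(w\circ_ix)\circ_j(y\circ_iz)=(w\circ_jy)\circ_i(x\circ_jz)$ ($i\neq j$, $\Delta_i(w,x),\Delta_i(y,z),\Delta_j(w,y),\Delta_j(x,z)$); $s_i(\mathcal{S}^i)\subseteq\mathcal{S}^{i+1}$, $\tilde s_i(\mathcal{S}^{i+1})\subseteq\mathcal{S}^i$; $\tilde s_is_ix=x$ ($x\in\mathcal{S}^i$), $s_i\tilde s_iy=y$ ($y\in\mathcal{S}^{i+1}$); for $x\in\mathcal{S}^j$: $\delta_j^\alpha s_jx=s_j\delta_{j+1}^\alpha x$, $\delta_i^\alpha s_jx=s_j\delta_i^\alpha x$ ($i\neq j,j+1$); for $x,y\in\mathcal{S}^i$: $s_i(x\circ_{i+1}y)=s_ix\circ_is_iy$ ($\Delta_{i+1}(x,y)$), $s_i(x\circ_jy)=s_ix\circ_js_iy$ ($j\neq i,i+1$, $\Delta_j(x,y)$); $s_ix=x$ on $\mathcal{S}^{i,i+1}$; $s_is_jx=s_js_ix$ ($|i-j|\geq2$, $x\in\mathcal{S}^{i,j}$); every $x$ lies in $\mathcal{S}^i$ for all large $i$; for $x\in\mathcal{S}^j$: $\delta_j^\alpha\gamma_j^\alpha x=x$, $\delta_{j+1}^\alpha\gamma_j^\alpha x=s_jx$, $\delta_i^\alpha\gamma_j^\beta x=\gamma_j^\beta\delta_i^\alpha x$ ($i\neq j,j+1$); for $x,y\in\mathcal{S}^i$ with $\Delta_{i+1}(x,y)$: $\gamma_i^+(x\circ_{i+1}y)=(\gamma_i^+x\circ_{i+1}s_ix)\circ_i(x\circ_{i+1}\gamma_i^+y)$,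 $\gamma_i^-(x\circ_{i+1}y)=(\gamma_i^-x\circ_{i+1}y)\circ_i(s_iy\circ_{i+1}\gamma_i^-y)$; $\gamma_i^\alpha(x\circ_jy)=\gamma_i^\alpha x\circ_j\gamma_i^\alpha y$ ($x,y\in\mathcal{S}^i$, $j\neq i,i+1$, $\Delta_j(x,y)$); $\gamma_i^\alpha x=x$ on $\mathcal{S}^{i,i+1}$; $\gamma_i^+x\circ_{i+1}\gamma_i^-x=x$, $\gamma_i^+x\circ_i\gamma_i^-x=s_ix$ ($x\in\mathcal{S}^i$); $\gamma_i^\alpha\gamma_j^\beta x=\gamma_j^\beta\gamma_i^\alpha x$ ($|i-j|\geq2$, $x\in\mathcal{S}^{i,j}$); $s_{i+1}s_i\gamma_{i+1}^\alpha x=\gamma_i^\alpha s_{i+1}x$ ($x\in\mathcal{S}^{i,i+1}$). A cell $x$ is $r_i$-invertible if there is $y$ with $\Delta_i(x,y)$, $x\circ_iy=\delta_i^-x$, $\Delta_i(y,x)$, $y\circ_ix=\delta_i^+x$; such $y$ is unique and denoted $r_ix$. A cell $x\in\mathcal{S}^{>n}$ has an $r_i$-invertible $(n-1)$-shell if $\delta_j^\alpha x$ is $r_i$-invertible for all $1\leq j\leq n$, $j\neq i$, and both $\alpha$. A single-set cubical $(\omega,p)$-category with connections is such an $\mathcal{S}$ in which, for all $n\geq p+1$ and $1\leq i\leq n$, every $x\in\mathcal{S}^{>n}$ with an $r_i$-invertible $(n-1)$-shell is $r_i$-invertible. -}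

module Defs where

open import Data.Nat using (ℕ; suc; _≤_; _<_)
open import Data.Product using (Σ; ∃; _×_; _,_)
open import Data.Sum using (_⊎_)
open import Relation.Binary.PropositionalEquality using (_≡_; _≢_)
open import Function.Bundles using (_⇔_)

data Sgn : Set where
  neg pos : Sgn

-- Single-set categories.  A multivalued composition
--   ⊙ : S × S → P(S)
-- is represented by its membership relation: (z ∈ x ⊙ y) ≔ _⊙_∋_ x y z.

record IsSingleSetCategory {S : Set} (δ⁻ δ⁺ : S → S) (_⊙_∋_ : S → S → S → Set) : Set₁ where
  field
    assoc    : ∀ x y z w → (Σ S λ u → (y ⊙ z ∋ u) × (x ⊙ u ∋ w))
                         ⇔ (Σ S λ u → (x ⊙ y ∋ u) × (u ⊙ z ∋ w))
    unitʳ    : ∀ x w → (x ⊙ δ⁺ x ∋ w) ⇔ (w ≡ x)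
    unitˡ    : ∀ x w → (δ⁻ x ⊙ x ∋ w) ⇔ (w ≡ x)
    defined  : ∀ x y → (Σ S λ w → x ⊙ y ∋ w) ⇔ (δ⁺ x ≡ δ⁻ y)
    atMostOne : ∀ x y w w′ → x ⊙ y ∋ w → x ⊙ y ∋ w′ → w ≡ w′

-- Dimension indices i ∈ ℕ₊ are represented SHIFTED by one:
-- the Agda index k : ℕ stands for the dimension k+1.  All axioms only
-- use i ≠ j, i+1 and |i-j| ≥ 2, which are invariant under this shift.

Far : ℕ → ℕ → Set
Far i j = (suc i < j) ⊎ (suc j < i)

record CubicalωCatConn (S : Set) : Set₁ where
  field
    δ   : ℕ → Sgn → S → S
    Comp : ℕ → S → S → S → Set      -- Comp i x y z  ⟺  z ∈ x ⊙ᵢ y  (i.e. Δᵢ(x,y) and x ∘ᵢ y = z)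
    s   : ℕ → S → S
    s̃   : ℕ → S → S
    γ   : ℕ → Sgn → S → S

  Cell : ℕ → S → Set
  Cell i x = δ i neg x ≡ x

  Cell₂ : ℕ → ℕ → S → Set
  Cell₂ i j x = Cell i x × Cell j x

  field
    isCat : ∀ i → IsSingleSetCategory (δ i neg) (δ i pos) (Comp i)

    δ-comm : ∀ i j α β x → i ≢ j → δ i α (δ j β x) ≡ δ j β (δ i α x)
    δ-comp : ∀ i j α x y z → i ≢ j → Comp j x y z
             → Comp j (δ i α x) (δ i α y) (δ i α z)
    interchange : ∀ i j w x y z a b c d → i ≢ j
             → Comp i w x a → Comp i y z b → Comp j w y c → Comp j x z d
             → Σ S λ e → Comp j a b e × Comp i c d e

    s-cell  : ∀ i x → Cell i x → Cell (suc i) (s i x)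
    s̃-cell  : ∀ i y → Cell (suc i) y → Cell i (s̃ i y)
    s̃s      : ∀ i x → Cell i x → s̃ i (s i x) ≡ x
    ss̃      : ∀ i y → Cell (suc i) y → s i (s̃ i y) ≡ y

    δ-s-same  : ∀ j α x → Cell j x → δ j α (s j x) ≡ s j (δ (suc j) α x)
    δ-s-other : ∀ i j α x → Cell j x → i ≢ j → i ≢ suc j
                → δ i α (s j x) ≡ s j (δ i α x)
    s-comp-suc : ∀ i x y z → Cell i x → Cell i y → Comp (suc i) x y z
                 → Comp i (s i x) (s i y) (s i z)
    s-comp-other : ∀ i j x y z → Cell i x → Cell i y → j ≢ i → j ≢ suc i
                 → Comp j x y z → Comp j (s i x) (s i y) (s i z)
    s-triv : ∀ i x → Cell₂ i (suc i) x → s i x ≡ x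
    s-comm : ∀ i j x → Far i j → Cell₂ i j x → s i (s j x) ≡ s j (s i x)

    finite-dim : ∀ x → Σ ℕ λ N → ∀ i → N ≤ i → Cell i x

    δ-γ-same : ∀ j α x → Cell j x → δ j α (γ j α x) ≡ x
    δ-γ-suc  : ∀ j α x → Cell j x → δ (suc j) α (γ j α x) ≡ s j x
    δ-γ-other : ∀ i j α β x → Cell j x → i ≢ j → i ≢ suc j
                → δ i α (γ j β x) ≡ γ j β (δ i α x)
    γ⁺-comp-suc : ∀ i x y z → Cell i x → Cell i y → Comp (suc i) x y z
                → Σ S λ a → Σ S λ b →
                    Comp (suc i) (γ i pos x) (s i x) a
                  × Comp (suc i) x (γ i pos y) b
                  × Comp i a b (γ i pos z)
    γ⁻-comp-suc : ∀ i x y z → Cell i x → Cell i y → Comp (suc i) x y z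
                → Σ S λ a → Σ S λ b →
                    Comp (suc i) (γ i neg x) y a
                  × Comp (suc i) (s i y) (γ i neg y) b
                  × Comp i a b (γ i neg z)
    γ-comp-other : ∀ i j α x y z → Cell i x → Cell i y → j ≢ i → j ≢ suc i
                 → Comp j x y z → Comp j (γ i α x) (γ i α y) (γ i α z)
    γ-triv : ∀ i α x → Cell₂ i (suc i) x → γ i α x ≡ x
    γ-inv-suc : ∀ i x → Cell i x → Comp (suc i) (γ i pos x) (γ i neg x) x
    γ-inv-same : ∀ i x → Cell i x → Comp i (γ i pos x) (γ i neg x) (s i x)
    γ-comm : ∀ i j α β x → Far i j → Cell₂ i j x
             → γ i α (γ j β x) ≡ γ j β (γ i α x)
    ss-γ : ∀ i α x → Cell₂ i (suc i) x
           → s (suc i) (s i (γ (suc i) α x)) ≡ γ i α (s (suc i) x)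

  -- S^{>n} = ⋂_{i>n} Sⁱ   (shifted: Agda index k stands for dimension k+1 > n ⟺ n ≤ k)
  Above : ℕ → S → Set
  Above n x = ∀ k → n ≤ k → Cell k x

  IsRInverse : ℕ → S → S → Set
  IsRInverse i x y = Comp i x y (δ i neg x) × Comp i y x (δ i pos x)

  RInvertible : ℕ → S → Set
  RInvertible i x = Σ S λ y → IsRInverse i x y

  -- x ∈ S^{>n} has an rᵢ-invertible (n-1)-shell:
  -- δⱼ^α x is rᵢ-invertible for all 1 ≤ j ≤ n (shifted: j < n), j ≠ i, both α
  InvShell : ℕ → ℕ → S → Set
  InvShell n i x = ∀ j α → j < n → j ≢ i → RInvertible i (δ j α x)

IsωpCategory : {S : Set} → ℕ → CubicalωCatConn S → Set
IsωpCategory p C = ∀ n i x → suc p ≤ n → i < n → Above n x → InvShell n i x → RInvertible i x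
  where open CubicalωCatConn C

-- Off its own direction i, the face δₖ⁻ (k ≠ i) commutes with ∘ᵢ and with δᵢ^±, so applying it
-- to the two inverse equations of x shows that δₖ⁻ y is again an rᵢ-inverse of x; inverses being
-- unique, δₖ⁻ y = y.  In direction i itself, x ∈ Sⁱ is an identity for ∘ᵢ, so its inverse is x.
module Submission where

open import Defs
open import Data.Nat using (ℕ)
open import Data.Nat.Properties using (_≟_)
open import Data.Product using (_,_)
open import Relation.Nullary using (yes; no)
open import Relation.Binary.PropositionalEquality
open import Function.Bundles using (Equivalence)

module SingleSetCategory {S : Set} {δ⁻ δ⁺ : S → S} {_⊙_∋_ : S → S → S → Set}
                         (K : IsSingleSetCategory δ⁻ δ⁺ _⊙_∋_) where
  open IsSingleSetCategory K
  open Equivalence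

  composable : ∀ {x y w} → x ⊙ y ∋ w → δ⁺ x ≡ δ⁻ y
  composable {x} {y} {w} xy = to (defined x y) (w , xy)

  identityʳ : ∀ x → x ⊙ δ⁺ x ∋ x
  identityʳ x = from (unitʳ x x) refl

  identityˡ : ∀ x → δ⁻ x ⊙ x ∋ x
  identityˡ x = from (unitˡ x x) refl

  δ⁺-of-identity : ∀ {x} → δ⁻ x ≡ x → δ⁺ x ≡ x
  δ⁺-of-identity {x} δ⁻x≡x = begin
    δ⁺ x        ≡⟨ cong δ⁺ (sym δ⁻x≡x) ⟩
    δ⁺ (δ⁻ x)   ≡⟨ composable (identityˡ x) ⟩
    δ⁻ x        ≡⟨ δ⁻x≡x ⟩
    x           ∎
    where open ≡-Reasoning

  -- y = y ∘ (x ∘ y′) = (y ∘ x) ∘ y′ = y′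
  leftInverse≡rightInverse : ∀ {x y y′} → y ⊙ x ∋ δ⁺ x → x ⊙ y′ ∋ δ⁻ x → y ≡ y′
  leftInverse≡rightInverse {x} {y} {y′} yx xy′
    with to (assoc y x y′ y)
            (δ⁻ x , xy′ , subst (λ t → y ⊙ t ∋ y) (composable yx) (identityʳ y))
  ... | u , yx≡u , uy′≡y with atMostOne y x u (δ⁺ x) yx≡u yx
  ... | refl = to (unitˡ y′ y) (subst (λ t → t ⊙ y′ ∋ y) (composable xy′) uy′≡y)

  rightInverse-of-identity : ∀ {x y} → δ⁻ x ≡ x → x ⊙ y ∋ δ⁻ x → y ≡ x
  rightInverse-of-identity {x} {y} δ⁻x≡x xy = begin
    y      ≡⟨ atMostOne x y y (δ⁻ x) xy≡y xy ⟩
    δ⁻ x   ≡⟨ δ⁻x≡x ⟩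
    x      ∎
    where
    open ≡-Reasoning
    xy≡y : x ⊙ y ∋ y
    xy≡y = subst (λ t → t ⊙ y ∋ y) (trans (sym (composable xy)) (δ⁺-of-identity δ⁻x≡x)) (identityˡ y)

module _ {S : Set} (C : CubicalωCatConn S) where
  open CubicalωCatConn C

  δ-preserves-rInverse : ∀ {i k x y} → k ≢ i → Cell k x →
                         IsRInverse i x y → IsRInverse i x (δ k neg y)
  δ-preserves-rInverse {i} {k} {x} {y} k≢i δₖx≡x (xy , yx) =
      subst₂ (λ a b → Comp i a (δ k neg y) b) δₖx≡x (δₖδᵢx≡δᵢx neg) (δ-comp k i neg x y _ k≢i xy)
    , subst₂ (λ a b → Comp i (δ k neg y) a b) δₖx≡x (δₖδᵢx≡δᵢx pos) (δ-comp k i neg y x _ k≢i yx)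
    where
    δₖδᵢx≡δᵢx : ∀ α → δ k neg (δ i α x) ≡ δ i α x
    δₖδᵢx≡δᵢx α = trans (δ-comm k i neg α x k≢i) (cong (δ i α) δₖx≡x)

  rInverse-cell-transverse : ∀ {i k x y} → k ≢ i → Cell k x → IsRInverse i x y → Cell k y
  rInverse-cell-transverse {i} k≢i δₖx≡x inv@(_ , yx) with δ-preserves-rInverse k≢i δₖx≡x inv
  ... | xδₖy , _ = sym (leftInverse≡rightInverse yx xδₖy)
    where open SingleSetCategory (isCat i)

  rInverse-cell-same : ∀ {i x y} → Cell i x → IsRInverse i x y → Cell i y
  rInverse-cell-same {i} {x} δᵢx≡x (xy , _) =
    subst (λ t → δ i neg t ≡ t) (sym (rightInverse-of-identity δᵢx≡x xy)) δᵢx≡x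
    where open SingleSetCategory (isCat i)

lemma2p4p7 : (S : Set) (p : ℕ) (C : CubicalωCatConn S) → IsωpCategory p C →
    (n i : ℕ) (x y : S) →
    CubicalωCatConn.Above C n x → CubicalωCatConn.IsRInverse C i x y →
    CubicalωCatConn.Above C n y
lemma2p4p7 S p C _ n i x y x-above inv k n≤k with k ≟ i
... | yes refl = rInverse-cell-same C (x-above k n≤k) inv
... | no k≢i   = rInverse-cell-transverse C k≢i (x-above k n≤k) inv
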